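{- Let $G$ be a graph that is both a VPT graph and a split graph, with split partition $(S,K)$. Then $K$ is a principal clique of $G$, i.e. $\max_{C\in\mathcal{C}(G)}\chi(B(G/C))=\chi(B(G/K))$.
   Context: All graphs are finite, simple and connected. A graph $G$ is VPT if it is the vertex intersection graph of a family of paths in a tree: there is a tree $T$ and paths $(P_v)_{v\in V(G)}$ of $T$ such that $uv\in E(G)$ iff $P_u$ and $P_v$ share a vertex. A clique is a maximal complete set; $\mathcal{C}(G)$ is the family of cliques of $G$. A graph is split if $V(G)$ can be partitioned into a stable set $S$ and a clique $K$; $(S,K)$ is the split partition and $K$ the central clique. For $C\in\mathcal{C}(G)$, the branch graph $B(G/C)$ has as vertices the vertices of $V(G)\setminus C$ adjacent to some vertex of $C$, and two such vertices $v,w$ are adjacent in $B(G/C)$ iff: $vw\notin E(G)$; there is $x\in C$ adjacent to both $v$ and $w$; there is $y\in C$ adjacent to $v$ but not to $w$; and there is $z\in C$ adjacent to $w$ but not to $v$. $\chi$ denotes chromatic number. A clique $K$ is principal if $\max_{C\in\mathcal{C}(G)}\chi(B(G/C))=\chi(B(G/K))$. -}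

module Defs where

open import Level using (0ℓ)
open import Data.Nat using (ℕ; zero; suc; _≤_; _<_)
open import Data.Fin using (Fin)
open import Data.Fin.Subset using (Subset; _∈_; _∉_)
open import Data.List using (List; []; _∷_; length; last)
open import Data.List.Membership.Propositional using () renaming (_∈_ to _∈ₗ_)
open import Data.List.Relation.Unary.Linked using (Linked)
open import Data.List.Relation.Unary.Unique.Propositional using (Unique)
open import Data.Maybe using (Maybe; just; nothing)
open import Data.Product using (Σ; ∃; _×_; _,_)
open import Data.Sum using (_⊎_)
open import Data.Empty using (⊥)
open import Relation.Nullary using (¬_; Dec)
open import Relation.Binary.PropositionalEquality using (_≡_; _≢_)
open import Function.Bundles using (_⇔_)

record Graph : Set₁ where
  field
    n      : ℕ
    Adj    : Fin n → Fin n → Set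
    adj?   : ∀ u v → Dec (Adj u v)
    sym    : ∀ {u v} → Adj u v → Adj v u
    irrefl : ∀ {u} → ¬ Adj u u

open Graph public

data Walk (G : Graph) : Fin (n G) → Fin (n G) → Set where
  here : ∀ {u} → Walk G u u
  step : ∀ {u v w} → Adj G u v → Walk G v w → Walk G u w

Connected : Graph → Set
Connected G = (0 < n G) × (∀ u v → Walk G u v)

record Cycle (G : Graph) : Set where
  field
    verts   : List (Fin (n G))
    long    : 3 ≤ length verts
    distinct : Unique verts
    linked  : Linked (Adj G) verts
    closing : ∀ {a b} → Data.List.head verts ≡ just a → last verts ≡ just b → Adj G b a

IsTree : Graph → Set
IsTree T = Connected T × ¬ Cycle T

record GPath (T : Graph) : Set where
  field
    verts    : List (Fin (n T))
    nonempty : 1 ≤ length verts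
    distinct : Unique verts
    linked   : Linked (Adj T) verts

open GPath public

IsVPT : Graph → Set₁
IsVPT G =
  Σ Graph λ T → IsTree T ×
  Σ (Fin (n G) → GPath T) λ P →
    ∀ u v → u ≢ v → (Adj G u v ⇔ (∃ λ x → (x ∈ₗ verts (P u)) × (x ∈ₗ verts (P v))))

Complete : (G : Graph) → Subset (n G) → Set
Complete G C = ∀ u v → u ∈ C → v ∈ C → u ≢ v → Adj G u v

IsClique : (G : Graph) → Subset (n G) → Set
IsClique G C = Complete G C × (∀ w → w ∉ C → ¬ (∀ u → u ∈ C → Adj G w u))

Stable : (G : Graph) → Subset (n G) → Set
Stable G S = ∀ u v → u ∈ S → v ∈ S → ¬ Adj G u v

IsSplitPartition : (G : Graph) → Subset (n G) → Subset (n G) → Set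
IsSplitPartition G S K =
  (∀ v → v ∈ S ⊎ v ∈ K) × (∀ v → v ∈ S → v ∈ K → ⊥) × Stable G S × IsClique G K

-- Branch graph B(G/C), given by its vertex set and adjacency on V(G)

InBranch : (G : Graph) → Subset (n G) → Fin (n G) → Set
InBranch G C v = v ∉ C × ∃ λ x → x ∈ C × Adj G v x

BranchAdj : (G : Graph) → Subset (n G) → Fin (n G) → Fin (n G) → Set
BranchAdj G C v w =
  InBranch G C v × InBranch G C w × ¬ Adj G v w ×
  (∃ λ x → x ∈ C × Adj G v x × Adj G w x) ×
  (∃ λ y → y ∈ C × Adj G v y × ¬ Adj G w y) ×
  (∃ λ z → z ∈ C × Adj G w z × ¬ Adj G v z)

BranchColourable : (G : Graph) → Subset (n G) → ℕ → Set
BranchColourable G C k =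
  Σ (Fin (n G) → Fin k) λ c → ∀ v w → BranchAdj G C v w → c v ≢ c w

IsBranchChromatic : (G : Graph) → Subset (n G) → ℕ → Set
IsBranchChromatic G C k =
  BranchColourable G C k × (∀ j → j < k → ¬ BranchColourable G C j)

-- K is principal: χ(B(G/K)) equals the maximum of χ(B(G/C)) over all cliques C
-- (K is itself a clique, and χ(B(G/C)) ≤ χ(B(G/K)) for every clique C).
IsPrincipal : (G : Graph) → Subset (n G) → Set
IsPrincipal G K =
  IsClique G K ×
  (∀ C a b → IsClique G C → IsBranchChromatic G C a → IsBranchChromatic G K b → a ≤ b)

-- Both ends of an edge vw of a branch graph B(G/C) of a split graph lie in the
-- stable set S: two non-adjacent vertices cannot both lie in K, and if v ∈ K,
-- w ∈ S, the witness z with w ~ z, v ≁ z lies in K, contradicting completeness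
-- of K. Every neighbour of a vertex of S lies in K, so the witnesses of the edge
-- lie in K and B(G/C) is a subgraph of B(G/K). A colouring of B(G/K) therefore
-- colours B(G/C), giving χ(B(G/C)) ≤ χ(B(G/K)). This works for every split
-- graph.
module Submission where

open import Defs
open import Data.Fin.Subset using (Subset; _∈_)
open import Data.Nat using (_≤_)
open import Data.Nat.Properties using (_≤?_; ≰⇒>)
open import Data.Product using (_,_; proj₁; proj₂)
open import Data.Sum using (inj₁; inj₂)
open import Data.Empty using (⊥-elim)
open import Relation.Nullary using (yes; no)
open import Relation.Binary.PropositionalEquality using (refl)

BranchAdj-sym : ∀ G C {v w} → BranchAdj G C v w → BranchAdj G C w v
BranchAdj-sym G C (v∈B , w∈B , v≁w , (x , x∈C , v~x , w~x) , y-wit , z-wit) =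
  w∈B , v∈B , (λ w~v → v≁w (sym G w~v)) , (x , x∈C , w~x , v~x) , z-wit , y-wit

BranchColourable-anti : ∀ G {C D} k →
  (∀ v w → BranchAdj G C v w → BranchAdj G D v w) →
  BranchColourable G D k → BranchColourable G C k
BranchColourable-anti G k C⊆D (c , proper) =
  c , λ v w e → proper v w (C⊆D v w e)

IsBranchChromatic-mono : ∀ G {C D a b} →
  (∀ v w → BranchAdj G C v w → BranchAdj G D v w) →
  IsBranchChromatic G C a → IsBranchChromatic G D b → a ≤ b
IsBranchChromatic-mono G {a = a} {b} C⊆D (_ , a-minimal) (D-colouring , _)
  with a ≤? b
... | yes a≤b = a≤b
... | no  a≰b = ⊥-elim (a-minimal b (≰⇒> a≰b) (BranchColourable-anti G b C⊆D D-colouring))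

module SplitPartition (G : Graph) {S K : Subset (n G)} (split : IsSplitPartition G S K) where

  K-clique : IsClique G K
  K-clique = proj₂ (proj₂ (proj₂ split))

  private
    cover      = proj₁ split
    disjoint   = proj₁ (proj₂ split)
    S-stable   = proj₁ (proj₂ (proj₂ split))
    K-complete = proj₁ K-clique

  neighbour∈K : ∀ {v y} → v ∈ S → Adj G v y → y ∈ K
  neighbour∈K {v} {y} v∈S v~y with cover y
  ... | inj₁ y∈S = ⊥-elim (S-stable v y v∈S y∈S v~y)
  ... | inj₂ y∈K = y∈K

  BranchAdj⇒∈S : ∀ C {v w} → BranchAdj G C v w → v ∈ S
  BranchAdj⇒∈S C {v} {w} (_ , _ , v≁w , _ , (y , _ , v~y , w≁y) , (z , _ , w~z , v≁z))
    with cover v | cover w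
  ... | inj₁ v∈S | _        = v∈S
  ... | inj₂ v∈K | inj₂ w∈K = ⊥-elim (v≁w (K-complete v w v∈K w∈K λ { refl → w≁y v~y }))
  ... | inj₂ v∈K | inj₁ w∈S =
    ⊥-elim (v≁z (K-complete v z v∈K (neighbour∈K w∈S w~z) λ { refl → v≁w (sym G w~z) }))

  InBranch-central : ∀ C {v} → v ∈ S → InBranch G C v → InBranch G K v
  InBranch-central C v∈S (_ , x , _ , v~x) =
    (λ v∈K → disjoint _ v∈S v∈K) , x , neighbour∈K v∈S v~x , v~x

  BranchAdj⇒BranchAdj-central : ∀ C v w → BranchAdj G C v w → BranchAdj G K v w
  BranchAdj⇒BranchAdj-central C v w
    e@(v∈B , w∈B , v≁w , (x , _ , v~x , w~x) , (y , _ , v~y , w≁y) , (z , _ , w~z , v≁z)) =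
    InBranch-central C v∈S v∈B , InBranch-central C w∈S w∈B , v≁w ,
    (x , neighbour∈K v∈S v~x , v~x , w~x) ,
    (y , neighbour∈K v∈S v~y , v~y , w≁y) ,
    (z , neighbour∈K w∈S w~z , w~z , v≁z)
    where
      v∈S = BranchAdj⇒∈S C e
      w∈S = BranchAdj⇒∈S C (BranchAdj-sym G C e)

lemma9 : (G : Graph) → Connected G → IsVPT G →
         (S K : Subset (n G)) → IsSplitPartition G S K →
         IsPrincipal G K
lemma9 G _ _ S K split =
  K-clique ,
  λ C a b _ χC≡a χK≡b →
    IsBranchChromatic-mono G (BranchAdj⇒BranchAdj-central C) χC≡a χK≡b
  where open SplitPartition G split
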